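{- Every bounded finitely subdirectly irreducible relevant algebra $\mathbf{A}$ is rigorously compact: if $\bot,\top$ are the least and greatest elements of $\mathbf{A}$, then $\top\cdot a=\top$ for every $a\in A$ with $a\neq\bot$.
   Context: A relevant algebra is an algebra $\langle A;\cdot,\wedge,\vee,\neg\rangle$ such that $\langle A;\cdot\rangle$ is a commutative semigroup, $\langle A;\wedge,\vee\rangle$ is a distributive lattice with order $\leqslant$, and for all $a,b,c$: $\neg\neg a=a\leqslant a\cdot a$; $a\leqslant b$ iff $\neg b\leqslant\neg a$; $a\cdot b\leqslant c$ iff $a\cdot\neg c\leqslant\neg b$; $a\leqslant a\cdot(\neg(b\cdot\neg b)\wedge\neg(c\cdot\neg c))$. Bounded means having a least element $\bot$ and a greatest element $\top$ (not necessarily distinguished operations). An algebra is finitely subdirectly irreducible if its identity relation is meet-irreducible in its congruence lattice. -}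

module Defs where

open import Level using (Level; suc)
open import Relation.Binary.PropositionalEquality using (_≡_)
open import Relation.Binary.Structures using (IsEquivalence)
open import Algebra.Core using (Op₁; Op₂)
import Algebra.Structures as AS
import Algebra.Lattice.Structures as ALS
open import Data.Sum using (_⊎_)
open import Data.Product using (_×_)
open import Relation.Nullary using (¬_)

record RelevantAlgebra (a : Level) : Set (suc a) where
  infixl 7 _·_
  infixr 6 _∧_
  infixr 5 _∨_
  infix 4 _≤_
  field
    Carrier : Set a
    _·_ : Op₂ Carrier
    _∧_ : Op₂ Carrier
    _∨_ : Op₂ Carrier
    ∼ : Op₁ Carrier

  _≤_ : Carrier → Carrier → Set a
  x ≤ y = x ∧ y ≡ x

  field
    ·-isCommutativeSemigroup : AS.IsCommutativeSemigroup {A = Carrier} _≡_ _·_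
    isDistributiveLattice : ALS.IsDistributiveLattice {A = Carrier} _≡_ _∨_ _∧_
    ∼∼ : ∀ x → ∼ (∼ x) ≡ x
    square-increasing : ∀ x → x ≤ x · x
    contraposition₁ : ∀ x y → x ≤ y → ∼ y ≤ ∼ x
    contraposition₂ : ∀ x y → ∼ y ≤ ∼ x → x ≤ y
    residuation₁ : ∀ x y z → x · y ≤ z → x · ∼ z ≤ ∼ y
    residuation₂ : ∀ x y z → x · ∼ z ≤ ∼ y → x · y ≤ z
    absorbs-identity : ∀ x y z → x ≤ x · (∼ (y · ∼ y) ∧ ∼ (z · ∼ z))

module _ {a : Level} (A : RelevantAlgebra a) where
  open RelevantAlgebra A

  record IsCongruence (θ : Carrier → Carrier → Set a) : Set a where
    field
      isEquivalence : IsEquivalence θ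
      ·-cong : ∀ {x x′ y y′} → θ x x′ → θ y y′ → θ (x · y) (x′ · y′)
      ∧-cong : ∀ {x x′ y y′} → θ x x′ → θ y y′ → θ (x ∧ y) (x′ ∧ y′)
      ∨-cong : ∀ {x x′ y y′} → θ x x′ → θ y y′ → θ (x ∨ y) (x′ ∨ y′)
      ∼-cong : ∀ {x x′} → θ x x′ → θ (∼ x) (∼ x′)

  -- θ is the identity relation (θ ⊆ id_A; id_A ⊆ θ holds by reflexivity)
  IsIdentity : (Carrier → Carrier → Set a) → Set a
  IsIdentity θ = ∀ x y → θ x y → x ≡ y

  -- id_A is meet-irreducible in Con A: id_A is not the top element A×A, and
  -- whenever θ ∩ ψ = id_A for congruences θ, ψ, then θ = id_A or ψ = id_A.
  FinitelySubdirectlyIrreducible : Set (suc a)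
  FinitelySubdirectlyIrreducible =
    (¬ (∀ (x y : Carrier) → x ≡ y)) ×
    (∀ (θ ψ : Carrier → Carrier → Set a) → IsCongruence θ → IsCongruence ψ →
       (∀ x y → θ x y → ψ x y → x ≡ y) →
       IsIdentity θ ⊎ IsIdentity ψ)

  IsLeast : Carrier → Set a
  IsLeast b = ∀ x → b ≤ x

  IsGreatest : Carrier → Set a
  IsGreatest t = ∀ x → x ≤ t

-- Call d an ideal element when ⊤ · d ≤ d.  Every product ⊤ · x is one,
-- because ⊤ · ⊤ = ⊤.  For an ideal element d:
--   * ∼ d is again an ideal element, d ∧ ∼ d is least and ∼ d ∨ d = ⊤,
--     so d is complemented by ∼ d (the least element is ∼ ⊤);
--   * the relation  u ψ_d v  ⟺  u ∨ d ≡ v ∨ d  is a congruence: it is a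
--     lattice congruence by distributivity, respects · because d · w ≤ d,
--     and respects ∼ because ∼ d is a complement of d;
--   * ψ_d ∩ ψ_{∼ d} is the identity, again since d ∧ ∼ d is least.
-- Finite subdirect irreducibility therefore makes ψ_d or ψ_{∼ d} the
-- identity, i.e. d ≡ ∼ ⊤ or d ≡ ⊤.  Applied to d = ⊤ · x the first case
-- forces x ≤ x · x ≤ ⊤ · x = ⊥, which is excluded.
module Submission where

open import Defs
open import Level using (Level)
open import Relation.Binary.PropositionalEquality using (_≡_; _≢_)
open import Relation.Binary.PropositionalEquality as Eq using (refl; sym; trans; cong; cong₂)
open import Data.Product using (_,_)
open import Data.Sum using (_⊎_; inj₁; inj₂)
open import Data.Empty using (⊥-elim)
open import Algebra.Core using (Op₂)
open import Algebra.Lattice.Bundles using (Lattice)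
import Algebra.Definitions as AD
import Algebra.Structures as AS
import Algebra.Lattice.Structures as ALS
import Algebra.Lattice.Properties.Lattice as LatticeProperties
import Relation.Binary.Lattice as OrderLattice
import Relation.Binary.Lattice.Properties.JoinSemilattice as JoinProperties

-- The standard library orders an
-- algebraic lattice by  x ≡ x ∧ y,  the mirror image of  x ≤ y  (x ∧ y ≡ x),
-- so each fact below is the library's statement read through  sym.
module Order {a : Level} (A : RelevantAlgebra a) where
  open RelevantAlgebra A

  lattice : Lattice a a
  lattice = record
    { isLattice = ALS.IsDistributiveLattice.isLattice isDistributiveLattice }

  open LatticeProperties lattice using (∨-∧-orderTheoreticLattice)
  private
    module O = OrderLattice.Lattice ∨-∧-orderTheoreticLattice

  ≤-refl : ∀ {x} → x ≤ x
  ≤-refl = sym O.refl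

  ≤-reflexive : ∀ {x y} → x ≡ y → x ≤ y
  ≤-reflexive refl = ≤-refl

  ≤-trans : ∀ {x y z} → x ≤ y → y ≤ z → x ≤ z
  ≤-trans p q = sym (O.trans (sym p) (sym q))

  ≤-antisym : ∀ {x y} → x ≤ y → y ≤ x → x ≡ y
  ≤-antisym p q = O.antisym (sym p) (sym q)

  x∧y≤x : ∀ x y → x ∧ y ≤ x
  x∧y≤x x y = sym (O.x∧y≤x x y)

  x∧y≤y : ∀ x y → x ∧ y ≤ y
  x∧y≤y x y = sym (O.x∧y≤y x y)

  ∧-greatest : ∀ {x y z} → x ≤ y → x ≤ z → x ≤ y ∧ z
  ∧-greatest p q = sym (O.∧-greatest (sym p) (sym q))

  x≤x∨y : ∀ x y → x ≤ x ∨ y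
  x≤x∨y x y = sym (O.x≤x∨y x y)

  y≤x∨y : ∀ x y → y ≤ x ∨ y
  y≤x∨y x y = sym (O.y≤x∨y x y)

  ∨-least : ∀ {x y z} → x ≤ z → y ≤ z → x ∨ y ≤ z
  ∨-least p q = sym (O.∨-least (sym p) (sym q))

  x≤y⇒x∨y≡y : ∀ {x y} → x ≤ y → x ∨ y ≡ y
  x≤y⇒x∨y≡y p = JoinProperties.x≤y⇒x∨y≈y O.joinSemilattice (sym p)

module Laws {a : Level} (A : RelevantAlgebra a) where
  open RelevantAlgebra A
  open Order A
  open AS.IsCommutativeSemigroup ·-isCommutativeSemigroup using (comm)

  ∼-antitone : ∀ {x y} → x ≤ y → ∼ y ≤ ∼ x
  ∼-antitone = contraposition₁ _ _

  ∼-galois : ∀ {x y} → x ≤ ∼ y → y ≤ ∼ x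
  ∼-galois {y = y} p = ≤-trans (≤-reflexive (sym (∼∼ y))) (∼-antitone p)

  residual-intro : ∀ {x w z} → x · w ≤ z → x ≤ ∼ (w · ∼ z)
  residual-intro {x} {w} {z} p =
    ∼-galois (residuation₁ w x z (≤-trans (≤-reflexive (comm w x)) p))

  residual-elim : ∀ {x w z} → x ≤ ∼ (w · ∼ z) → x · w ≤ z
  residual-elim {x} {w} {z} p =
    ≤-trans (≤-reflexive (comm x w)) (residuation₂ w x z (∼-galois p))

  -- Multiplication is monotone, being a left adjoint.
  ·-monoˡ : ∀ {x y w} → x ≤ y → x · w ≤ y · w
  ·-monoˡ p = residual-elim (≤-trans p (residual-intro ≤-refl))

  ·-monoʳ : ∀ {x y w} → x ≤ y → w · x ≤ w · y
  ·-monoʳ {x} {y} {w} p =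
    ≤-trans (≤-reflexive (comm w x)) (≤-trans (·-monoˡ p) (≤-reflexive (comm y w)))

  ·-distribʳ-∨ : ∀ u v w → (u ∨ v) · w ≤ u · w ∨ v · w
  ·-distribʳ-∨ u v w = residual-elim (∨-least
    (residual-intro (x≤x∨y (u · w) (v · w)))
    (residual-intro (y≤x∨y (u · w) (v · w))))

  ∼-∨ : ∀ u v → ∼ (u ∨ v) ≡ ∼ u ∧ ∼ v
  ∼-∨ u v = ≤-antisym
    (∧-greatest (∼-antitone (x≤x∨y u v)) (∼-antitone (y≤x∨y u v)))
    (∼-galois (∨-least (∼-galois (x∧y≤x (∼ u) (∼ v))) (∼-galois (x∧y≤y (∼ u) (∼ v)))))

module Bounded {a : Level} (A : RelevantAlgebra a)
               (top : RelevantAlgebra.Carrier A) (isTop : IsGreatest A top) where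
  open RelevantAlgebra A
  open Order A
  open Laws A
  open ALS.IsDistributiveLattice isDistributiveLattice
    using (∧-comm; ∨-comm; ∨-assoc; ∨-distribˡ-∧; ∨-distribʳ-∧)
  open LatticeProperties lattice using (∨-idem)
  open AS.IsCommutativeSemigroup ·-isCommutativeSemigroup using (comm; assoc)
  open Eq.≡-Reasoning

  ∼top-least : IsLeast A (∼ top)
  ∼top-least x = ≤-trans (∼-antitone (isTop (∼ x))) (≤-reflexive (∼∼ x))

  top·top : top · top ≡ top
  top·top = ≤-antisym (isTop _) (square-increasing top)

  IsIdealElement : Carrier → Set a
  IsIdealElement d = top · d ≤ d

  ideal-absorbs : ∀ {d} → IsIdealElement d → ∀ w → d · w ≤ d
  ideal-absorbs {d} ideal w =
    ≤-trans (≤-reflexive (comm d w)) (≤-trans (·-monoˡ (isTop w)) ideal)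

  top·-ideal : ∀ x → IsIdealElement (top · x)
  top·-ideal x = ≤-reflexive (trans (sym (assoc top top x)) (cong (_· x) top·top))

  ∼-ideal : ∀ {d} → IsIdealElement d → IsIdealElement (∼ d)
  ∼-ideal {d} ideal = residuation₁ top d d ideal

  ideal-disjoint : ∀ {d} → IsIdealElement d → d ∧ ∼ d ≤ ∼ top
  ideal-disjoint {d} ideal = ≤-trans (square-increasing (d ∧ ∼ d))
    (≤-trans (·-monoˡ (x∧y≤x d (∼ d))) (≤-trans (·-monoʳ (x∧y≤y d (∼ d))) d·∼d≤∼top))
    where
    d·∼d≤∼top : d · ∼ d ≤ ∼ top
    d·∼d≤∼top = residuation₂ d (∼ d) (∼ top)
      (≤-trans (ideal-absorbs ideal (∼ (∼ top))) (≤-reflexive (sym (∼∼ d))))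

  ideal-covers : ∀ {d} → IsIdealElement d → ∼ d ∨ d ≡ top
  ideal-covers {d} ideal = ≤-antisym (isTop _) (contraposition₂ top (∼ d ∨ d)
    (≤-trans (≤-reflexive (∼-∨ (∼ d) d))
      (≤-trans (≤-reflexive (cong (_∧ ∼ d) (∼∼ d))) (ideal-disjoint ideal))))

  JoinCongruence : Carrier → Carrier → Carrier → Set a
  JoinCongruence d u v = u ∨ d ≡ v ∨ d

  module _ {d : Carrier} (ideal : IsIdealElement d) where
    private
      ψ = JoinCongruence d

    AbsorbsLeft : Op₂ Carrier → Set a
    AbsorbsLeft _∘_ = ∀ u w → (u ∘ w) ∨ d ≡ ((u ∨ d) ∘ w) ∨ d

    compatible : ∀ {_∘_} → AD.Commutative _≡_ _∘_ → AbsorbsLeft _∘_ →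
      ∀ {x x′ y y′} → ψ x x′ → ψ y y′ → ψ (x ∘ y) (x′ ∘ y′)
    compatible {_∘_} ∘-comm absorbs {x} {x′} {y} {y′} p q = begin
      (x ∘ y) ∨ d    ≡⟨ leftCompatible p ⟩
      (x′ ∘ y) ∨ d   ≡⟨ cong (_∨ d) (∘-comm x′ y) ⟩
      (y ∘ x′) ∨ d   ≡⟨ leftCompatible q ⟩
      (y′ ∘ x′) ∨ d  ≡⟨ cong (_∨ d) (∘-comm y′ x′) ⟩
      (x′ ∘ y′) ∨ d  ∎
      where
      leftCompatible : ∀ {u u′ w} → ψ u u′ → ψ (u ∘ w) (u′ ∘ w)
      leftCompatible {u} {u′} {w} r = begin
        (u ∘ w) ∨ d          ≡⟨ absorbs u w ⟩
        ((u ∨ d) ∘ w) ∨ d    ≡⟨ cong (λ t → (t ∘ w) ∨ d) r ⟩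
        ((u′ ∨ d) ∘ w) ∨ d   ≡⟨ absorbs u′ w ⟨
        (u′ ∘ w) ∨ d         ∎

    ∨-absorbsLeft : AbsorbsLeft _∨_
    ∨-absorbsLeft u w = sym (begin
      ((u ∨ d) ∨ w) ∨ d   ≡⟨ cong (_∨ d) (∨-assoc u d w) ⟩
      (u ∨ (d ∨ w)) ∨ d   ≡⟨ cong (λ t → (u ∨ t) ∨ d) (∨-comm d w) ⟩
      (u ∨ (w ∨ d)) ∨ d   ≡⟨ cong (_∨ d) (∨-assoc u w d) ⟨
      ((u ∨ w) ∨ d) ∨ d   ≡⟨ ∨-assoc (u ∨ w) d d ⟩
      (u ∨ w) ∨ (d ∨ d)   ≡⟨ cong ((u ∨ w) ∨_) (∨-idem d) ⟩
      (u ∨ w) ∨ d         ∎)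

    ∧-absorbsLeft : AbsorbsLeft _∧_
    ∧-absorbsLeft u w = begin
      (u ∧ w) ∨ d              ≡⟨ ∨-distribʳ-∧ d u w ⟩
      (u ∨ d) ∧ (w ∨ d)        ≡⟨ cong (_∧ (w ∨ d)) (x≤y⇒x∨y≡y (y≤x∨y u d)) ⟨
      (d ∨ u ∨ d) ∧ (w ∨ d)    ≡⟨ cong (_∧ (w ∨ d)) (∨-comm d (u ∨ d)) ⟩
      ((u ∨ d) ∨ d) ∧ (w ∨ d)  ≡⟨ ∨-distribʳ-∧ d (u ∨ d) w ⟨
      ((u ∨ d) ∧ w) ∨ d        ∎

    -- Here the ideal property enters: (u ∨ d) · w ≤ u · w ∨ d · w ≤ u · w ∨ d.
    ·-absorbsLeft : AbsorbsLeft _·_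
    ·-absorbsLeft u w = ≤-antisym
      (∨-least (≤-trans (·-monoˡ (x≤x∨y u d)) (x≤x∨y _ d)) (y≤x∨y _ d))
      (∨-least
        (≤-trans (·-distribʳ-∨ u d w)
          (∨-least (x≤x∨y (u · w) d) (≤-trans (ideal-absorbs ideal w) (y≤x∨y (u · w) d))))
        (y≤x∨y _ d))

    -- Here complementation enters: ∼ u ∨ d is determined by u ∨ d.
    ∼-modulo : ∀ u → ∼ u ∨ d ≡ ∼ (u ∨ d) ∨ d
    ∼-modulo u = sym (begin
      ∼ (u ∨ d) ∨ d            ≡⟨ cong (_∨ d) (∼-∨ u d) ⟩
      (∼ u ∧ ∼ d) ∨ d          ≡⟨ ∨-distribʳ-∧ d (∼ u) (∼ d) ⟩
      (∼ u ∨ d) ∧ (∼ d ∨ d)    ≡⟨ cong ((∼ u ∨ d) ∧_) (ideal-covers ideal) ⟩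
      (∼ u ∨ d) ∧ top          ≡⟨ isTop _ ⟩
      ∼ u ∨ d                  ∎)

    joinCongruence-isCongruence : IsCongruence A ψ
    joinCongruence-isCongruence = record
      { isEquivalence = record { refl = refl ; sym = sym ; trans = trans }
      ; ·-cong = compatible comm ·-absorbsLeft
      ; ∧-cong = compatible ∧-comm ∧-absorbsLeft
      ; ∨-cong = compatible ∨-comm ∨-absorbsLeft
      ; ∼-cong = λ {x} {x′} p →
          trans (∼-modulo x) (trans (cong (λ t → ∼ t ∨ d) p) (sym (∼-modulo x′)))
      }

    joinCongruences-separate : ∀ u v → ψ u v → JoinCongruence (∼ d) u v → u ≡ v
    joinCongruences-separate u v p q = begin
      u                        ≡⟨ recover u ⟨
      (u ∨ d) ∧ (u ∨ ∼ d)      ≡⟨ cong₂ _∧_ p q ⟩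
      (v ∨ d) ∧ (v ∨ ∼ d)      ≡⟨ recover v ⟩
      v                        ∎
      where
      recover : ∀ w → (w ∨ d) ∧ (w ∨ ∼ d) ≡ w
      recover w = begin
        (w ∨ d) ∧ (w ∨ ∼ d)    ≡⟨ ∨-distribˡ-∧ w d (∼ d) ⟨
        w ∨ (d ∧ ∼ d)          ≡⟨ ∨-comm w (d ∧ ∼ d) ⟩
        (d ∧ ∼ d) ∨ w          ≡⟨ x≤y⇒x∨y≡y (≤-trans (ideal-disjoint ideal) (∼top-least w)) ⟩
        w                      ∎

  identity⇒least : ∀ d → IsIdentity A (JoinCongruence d) → d ≡ ∼ top
  identity⇒least d identity =
    identity d (∼ top) (trans (∨-idem d) (sym (x≤y⇒x∨y≡y (∼top-least d))))

  ideal-dichotomy : FinitelySubdirectlyIrreducible A →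
    ∀ {d} → IsIdealElement d → (d ≡ ∼ top) ⊎ (d ≡ top)
  ideal-dichotomy (_ , irreducible) {d} ideal
    with irreducible (JoinCongruence d) (JoinCongruence (∼ d))
           (joinCongruence-isCongruence ideal)
           (joinCongruence-isCongruence (∼-ideal ideal))
           (joinCongruences-separate ideal)
  ... | inj₁ ψ-identity = inj₁ (identity⇒least d ψ-identity)
  ... | inj₂ ψ∼-identity = inj₂ (begin
    d          ≡⟨ ∼∼ d ⟨
    ∼ (∼ d)    ≡⟨ cong ∼ (identity⇒least (∼ d) ψ∼-identity) ⟩
    ∼ (∼ top)  ≡⟨ ∼∼ top ⟩
    top        ∎)

theorem7p13 : {a : Level} (A : RelevantAlgebra a) →
    FinitelySubdirectlyIrreducible A →
    (bot top : RelevantAlgebra.Carrier A) →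
    IsLeast A bot → IsGreatest A top →
    ∀ (x : RelevantAlgebra.Carrier A) → x ≢ bot →
    RelevantAlgebra._·_ A top x ≡ top
theorem7p13 A fsi bot top isBot isTop x x≢bot
  with Bounded.ideal-dichotomy A top isTop fsi (Bounded.top·-ideal A top isTop x)
... | inj₂ top·x≡top = top·x≡top
... | inj₁ top·x≡∼top = ⊥-elim (x≢bot (≤-antisym x≤bot (isBot x)))
  where
  open RelevantAlgebra A
  open Order A
  open Laws A using (·-monoˡ)
  open Bounded A top isTop using (∼top-least)

  x≤bot : x ≤ bot
  x≤bot = ≤-trans (square-increasing x) (≤-trans (·-monoˡ (isTop x))
            (≤-trans (≤-reflexive top·x≡∼top) (∼top-least bot)))
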